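{- The shuffle product ${\sqcup\!\sqcup}_\star \colon \mathbb{Q}\langle x_0,x_1 \rangle \otimes \mathbb{Q}\langle x_0,x_1 \rangle\to \mathbb{Q}\langle x_0,x_1 \rangle $ can be calculated in terms of the ordinary shuffle product ${\sqcup\!\sqcup}$ via the formula \begin{align*} ua \,{\sqcup\!\sqcup}_\star\, vb = ua \,{\sqcup\!\sqcup}\, vb - (u \,{\sqcup\!\sqcup}\, v \tau(b))a - (u\tau(a) \,{\sqcup\!\sqcup}\, v)b \end{align*} for words $u,v$ and letters $a,b\in\{x_0,x_1\}$.
   Context: On $\mathbb{Q}\langle x_0,x_1\rangle$ with empty word $\mathbf{1}$, the ordinary shuffle product is defined by $\mathbf{1}\,{\sqcup\!\sqcup}\, w=w\,{\sqcup\!\sqcup}\,\mathbf{1}=w$ and $au\,{\sqcup\!\sqcup}\, bv=a(u\,{\sqcup\!\sqcup}\, bv)+b(au\,{\sqcup\!\sqcup}\, v)$ for letters $a,b\in\{x_0,x_1\}$. $\tau$ is the anti-automorphism with $\tau(x_0)=x_1$, $\tau(x_1)=x_0$ (on letters it swaps $x_0$ and $x_1$). The shuffle product of multiple zeta star values (Muneta) ${\sqcup\!\sqcup}_\star$ is defined iteratively by $\mathbf{1}\, {\sqcup\!\sqcup}_\star\, u = u\,{\sqcup\!\sqcup}_\star\, \mathbf{1} = u$ and $a u \,{\sqcup\!\sqcup}_\star\, bv = a (u \,{\sqcup\!\sqcup}_\star\, bv) + b(a u \,{\sqcup\!\sqcup}_\star\, v) - \delta(u)\tau(a)bv - \delta(v)\tau(b)au$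 for words $u,v$ and letters $a,b\in \{x_0,x_1\}$, where $\delta(w)=1$ if $w=\mathbf{1}$ and $\delta(w)=0$ otherwise. -}

module Defs where

open import Data.List using (List; []; _∷_; _++_; map; [_])
open import Data.List.Properties using (≡-dec)
open import Data.Product using (_×_; _,_)
open import Data.Rational using (ℚ; 0ℚ; 1ℚ; -_; _+_; _*_)
open import Relation.Binary.PropositionalEquality using (_≡_; refl)
open import Relation.Nullary using (yes; no; Dec)

data Letter : Set where
  x₀ x₁ : Letter

_≟L_ : (a b : Letter) → Dec (a ≡ b)
x₀ ≟L x₀ = yes refl
x₀ ≟L x₁ = no (λ ())
x₁ ≟L x₀ = no (λ ())
x₁ ≟L x₁ = yes refl

Word : Set
Word = List Letter

_≟W_ : (u v : Word) → Dec (u ≡ v)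
_≟W_ = ≡-dec _≟L_

-- Elements of ℚ⟨x₀,x₁⟩: finite formal ℚ-linear combinations of words,
-- compared via their coefficient functions (see _≈_ below).
Poly : Set
Poly = List (ℚ × Word)

coeff : Poly → Word → ℚ
coeff [] w = 0ℚ
coeff ((c , u) ∷ p) w with u ≟W w
... | yes _ = c + coeff p w
... | no  _ = coeff p w

infix 4 _≈_
_≈_ : Poly → Poly → Set
p ≈ q = ∀ w → coeff p w ≡ coeff q w

word : Word → Poly
word w = [ (1ℚ , w) ]

infixl 6 _⊕_ _⊖_
_⊕_ : Poly → Poly → Poly
p ⊕ q = p ++ q

⊝_ : Poly → Poly
⊝ p = map (λ { (c , u) → (- c , u) }) p

_⊖_ : Poly → Poly → Poly
p ⊖ q = p ⊕ ⊝ q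

_·_ : ℚ → Poly → Poly
k · p = map (λ { (c , u) → (k * c , u) }) p

infixr 7 _◁_
_◁_ : Letter → Poly → Poly
a ◁ p = map (λ { (c , u) → (c , a ∷ u) }) p

infixl 7 _▷_
_▷_ : Poly → Letter → Poly
p ▷ a = map (λ { (c , u) → (c , u ++ [ a ]) }) p

τ : Letter → Letter
τ x₀ = x₁
τ x₁ = x₀

δ : Word → ℚ
δ []      = 1ℚ
δ (_ ∷ _) = 0ℚ

infixl 8 _⧢_
_⧢_ : Word → Word → Poly
[]      ⧢ v = word v
(a ∷ u) ⧢ v = go v
  where
  go : Word → Poly
  go []      = word (a ∷ u)
  go (b ∷ w) = (a ◁ (u ⧢ (b ∷ w))) ⊕ (b ◁ go w)

-- shuffle product of multiple zeta star values (Muneta) on words: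
-- au ⧢⋆ bv = a(u ⧢⋆ bv) + b(au ⧢⋆ v) - δ(u) τ(a) b v - δ(v) τ(b) a u
infixl 8 _⧢⋆_
_⧢⋆_ : Word → Word → Poly
[]      ⧢⋆ v = word v
(a ∷ u) ⧢⋆ v = go v
  where
  go : Word → Poly
  go []      = word (a ∷ u)
  go (b ∷ w) = (a ◁ (u ⧢⋆ (b ∷ w))) ⊕ (b ◁ go w)
               ⊖ (δ u · word (τ a ∷ b ∷ w))
               ⊖ (δ w · word (τ b ∷ a ∷ u))

-- Splitting off the first letters of ua and vb, both sides satisfy the same
-- recursion: as long as the remaining words still end in a or b the
-- δ-corrections of ⧢⋆ vanish, and when u or v is empty the surviving
-- correction τ(a)·vb or τ(b)·ua is exactly the term split off from
-- (u ⧢ vτ(b))a or (uτ(a) ⧢ v)b. Equality in ℚ⟨x₀,x₁⟩ is coefficientwise, so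
-- regrouping the terms reduces to identities in the ring ℚ.
module Submission where

open import Defs
open import Data.List using ([]; _∷_; _++_; [_]; _∷ʳ_)
open import Data.List.Properties using (map-++; ∷-injectiveˡ; ∷-injectiveʳ)
open import Data.Maybe using (nothing)
open import Data.Product using (_,_)
open import Data.Rational using (0ℚ; -_; _+_; _-_; _*_)
open import Data.Rational.Properties
  using (+-identityˡ; +-identityʳ; +-assoc; neg-distrib-+; *-zeroˡ; *-zeroʳ; *-distribˡ-+; +-*-commutativeRing)
open import Function using (_∘_)
open import Level using (0ℓ)
open import Relation.Binary.Bundles using (Setoid)
open import Relation.Binary.PropositionalEquality
  using (_≡_; _≢_; refl; sym; trans; cong; cong₂; module ≡-Reasoning)
import Relation.Binary.Reasoning.Setoid as SetoidReasoning
open import Relation.Nullary using (Dec; yes; no; contradiction)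
open import Tactic.RingSolver using (solve-∀)
open import Tactic.RingSolver.Core.AlmostCommutativeRing
  using (AlmostCommutativeRing; fromCommutativeRing)

-- The zero test only speeds up normalisation, so none is supplied.
ℚ-ring : AlmostCommutativeRing 0ℓ 0ℓ
ℚ-ring = fromCommutativeRing +-*-commutativeRing (λ _ → nothing)

coeff-∷-≡ : ∀ k u p → coeff ((k , u) ∷ p) u ≡ k + coeff p u
coeff-∷-≡ k u p with u ≟W u
... | yes _  = refl
... | no u≢u = contradiction refl u≢u

coeff-∷-≢ : ∀ {k u w} p → u ≢ w → coeff ((k , u) ∷ p) w ≡ coeff p w
coeff-∷-≢ {u = u} {w} p u≢w with u ≟W w
... | yes u≡w = contradiction u≡w u≢w
... | no _    = refl

coeff-⊕ : ∀ p q w → coeff (p ⊕ q) w ≡ coeff p w + coeff q w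
coeff-⊕ []            q w = sym (+-identityˡ _)
coeff-⊕ ((k , u) ∷ p) q w with u ≟W w
... | yes _ = trans (cong (k +_) (coeff-⊕ p q w)) (sym (+-assoc k _ _))
... | no _  = coeff-⊕ p q w

coeff-⊝ : ∀ p w → coeff (⊝ p) w ≡ - coeff p w
coeff-⊝ []            w = refl
coeff-⊝ ((k , u) ∷ p) w with u ≟W w
... | yes _ = trans (cong (- k +_) (coeff-⊝ p w)) (sym (neg-distrib-+ k _))
... | no _  = coeff-⊝ p w

coeff-⊖ : ∀ p q w → coeff (p ⊖ q) w ≡ coeff p w - coeff q w
coeff-⊖ p q w = trans (coeff-⊕ p (⊝ q) w) (cong (coeff p w +_) (coeff-⊝ q w))

coeff-· : ∀ k p w → coeff (k · p) w ≡ k * coeff p w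
coeff-· k []            w = sym (*-zeroʳ k)
coeff-· k ((c , u) ∷ p) w with u ≟W w
... | yes _ = trans (cong (k * c +_) (coeff-· k p w)) (sym (*-distribˡ-+ k c _))
... | no _  = coeff-· k p w

coeff-◁-[] : ∀ c p → coeff (c ◁ p) [] ≡ 0ℚ
coeff-◁-[] c []            = refl
coeff-◁-[] c ((k , u) ∷ p) = trans (coeff-∷-≢ {k} {c ∷ u} (c ◁ p) λ ()) (coeff-◁-[] c p)

coeff-◁-≡ : ∀ c p w → coeff (c ◁ p) (c ∷ w) ≡ coeff p w
coeff-◁-≡ c []            w = refl
coeff-◁-≡ c ((k , u) ∷ p) w = by-cases (u ≟W w)
  where
  by-cases : Dec (u ≡ w) → coeff (c ◁ ((k , u) ∷ p)) (c ∷ w) ≡ coeff ((k , u) ∷ p) w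
  by-cases (yes refl) = begin
    coeff (c ◁ ((k , u) ∷ p)) (c ∷ u) ≡⟨ coeff-∷-≡ k (c ∷ u) (c ◁ p) ⟩
    k + coeff (c ◁ p) (c ∷ u)         ≡⟨ cong (k +_) (coeff-◁-≡ c p u) ⟩
    k + coeff p u                     ≡⟨ coeff-∷-≡ k u p ⟨
    coeff ((k , u) ∷ p) u             ∎
    where open ≡-Reasoning
  by-cases (no u≢w) = begin
    coeff (c ◁ ((k , u) ∷ p)) (c ∷ w) ≡⟨ coeff-∷-≢ {k} {c ∷ u} (c ◁ p) (u≢w ∘ ∷-injectiveʳ) ⟩
    coeff (c ◁ p) (c ∷ w)             ≡⟨ coeff-◁-≡ c p w ⟩
    coeff p w                         ≡⟨ coeff-∷-≢ p u≢w ⟨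
    coeff ((k , u) ∷ p) w             ∎
    where open ≡-Reasoning

coeff-◁-≢ : ∀ {c d} p w → c ≢ d → coeff (c ◁ p) (d ∷ w) ≡ 0ℚ
coeff-◁-≢ []              w c≢d = refl
coeff-◁-≢ {c} {d} ((k , u) ∷ p) w c≢d =
  trans (coeff-∷-≢ {k} {c ∷ u} {d ∷ w} _ (c≢d ∘ ∷-injectiveˡ)) (coeff-◁-≢ p w c≢d)

≈-setoid : Setoid _ _
≈-setoid = record
  { Carrier       = Poly
  ; _≈_           = _≈_
  ; isEquivalence = record
    { refl  = λ _ → refl
    ; sym   = λ p≈q w → sym (p≈q w)
    ; trans = λ p≈q q≈r w → trans (p≈q w) (q≈r w)
    }
  }

-- p ≈ q unfolds to a function type over coefficients, from which Agda cannot
-- recover p and q; hence the polynomials are explicit arguments.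
⊕-congˡ : ∀ p p′ q → p ≈ p′ → p ⊕ q ≈ p′ ⊕ q
⊕-congˡ p p′ q p≈p′ w =
  trans (coeff-⊕ p q w) (trans (cong (_+ coeff q w) (p≈p′ w)) (sym (coeff-⊕ p′ q w)))

⊕-congʳ : ∀ p q q′ → q ≈ q′ → p ⊕ q ≈ p ⊕ q′
⊕-congʳ p q q′ q≈q′ w =
  trans (coeff-⊕ p q w) (trans (cong (coeff p w +_) (q≈q′ w)) (sym (coeff-⊕ p q′ w)))

⊖-congˡ : ∀ p p′ q → p ≈ p′ → p ⊖ q ≈ p′ ⊖ q
⊖-congˡ p p′ q p≈p′ w =
  trans (coeff-⊖ p q w) (trans (cong (_- coeff q w) (p≈p′ w)) (sym (coeff-⊖ p′ q w)))

◁-cong : ∀ c p q → p ≈ q → c ◁ p ≈ c ◁ q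
◁-cong c p q p≈q [] = trans (coeff-◁-[] c p) (sym (coeff-◁-[] c q))
◁-cong c p q p≈q (d ∷ w) with c ≟L d
... | yes refl = trans (coeff-◁-≡ c p w) (trans (p≈q w) (sym (coeff-◁-≡ c q w)))
... | no c≢d   = trans (coeff-◁-≢ p w c≢d) (sym (coeff-◁-≢ q w c≢d))

⊖-0· : ∀ p q → p ⊖ 0ℚ · q ≈ p
⊖-0· p q w = begin
  coeff (p ⊖ 0ℚ · q) w             ≡⟨ coeff-⊖ p (0ℚ · q) w ⟩
  coeff p w - coeff (0ℚ · q) w     ≡⟨ cong (λ x → coeff p w - x) (coeff-· 0ℚ q w) ⟩
  coeff p w - 0ℚ * coeff q w       ≡⟨ cong (λ x → coeff p w - x) (*-zeroˡ (coeff q w)) ⟩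
  coeff p w + 0ℚ                   ≡⟨ +-identityʳ (coeff p w) ⟩
  coeff p w                        ∎
  where open ≡-Reasoning

⊖-⊖-comm : ∀ p q r → p ⊖ q ⊖ r ≈ p ⊖ r ⊖ q
⊖-⊖-comm p q r w
  rewrite coeff-⊖ (p ⊖ q) r w | coeff-⊖ p q w | coeff-⊖ (p ⊖ r) q w | coeff-⊖ p r w
  = identity (coeff p w) (coeff q w) (coeff r w)
  where
  identity : ∀ x y z → x - y - z ≡ x - z - y
  identity = solve-∀ ℚ-ring

⊖⊖-⊕-⊖⊖ : ∀ p q r p′ q′ r′ →
  (p ⊖ q ⊖ r) ⊕ (p′ ⊖ q′ ⊖ r′) ≈ (p ⊕ p′) ⊖ (q ⊕ q′) ⊖ (r ⊕ r′)
⊖⊖-⊕-⊖⊖ p q r p′ q′ r′ w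
  rewrite coeff-⊕ (p ⊖ q ⊖ r) (p′ ⊖ q′ ⊖ r′) w
        | coeff-⊖ (p ⊖ q) r w | coeff-⊖ p q w | coeff-⊖ (p′ ⊖ q′) r′ w | coeff-⊖ p′ q′ w
        | coeff-⊖ ((p ⊕ p′) ⊖ (q ⊕ q′)) (r ⊕ r′) w | coeff-⊖ (p ⊕ p′) (q ⊕ q′) w
        | coeff-⊕ p p′ w | coeff-⊕ q q′ w | coeff-⊕ r r′ w
  = identity (coeff p w) (coeff q w) (coeff r w) (coeff p′ w) (coeff q′ w) (coeff r′ w)
  where
  identity : ∀ x y z x′ y′ z′ → (x - y - z) + (x′ - y′ - z′) ≡ (x + x′) - (y + y′) - (z + z′)
  identity = solve-∀ ℚ-ring

⊖⊖-⊕-⊖ : ∀ p q r s t → (p ⊖ q ⊖ r) ⊕ s ⊖ t ≈ (p ⊕ s) ⊖ (q ⊕ t) ⊖ r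
⊖⊖-⊕-⊖ p q r s t w
  rewrite coeff-⊖ ((p ⊖ q ⊖ r) ⊕ s) t w | coeff-⊕ (p ⊖ q ⊖ r) s w
        | coeff-⊖ (p ⊖ q) r w | coeff-⊖ p q w
        | coeff-⊖ ((p ⊕ s) ⊖ (q ⊕ t)) r w | coeff-⊖ (p ⊕ s) (q ⊕ t) w
        | coeff-⊕ p s w | coeff-⊕ q t w
  = identity (coeff p w) (coeff q w) (coeff r w) (coeff s w) (coeff t w)
  where
  identity : ∀ x y z x′ y′ → (x - y - z) + x′ - y′ ≡ (x + x′) - (y + y′) - z
  identity = solve-∀ ℚ-ring

⊕-⊖⊖-⊖ : ∀ s p q r t → s ⊕ (p ⊖ q ⊖ r) ⊖ t ≈ (s ⊕ p) ⊖ q ⊖ (t ⊕ r)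
⊕-⊖⊖-⊖ s p q r t w
  rewrite coeff-⊖ (s ⊕ (p ⊖ q ⊖ r)) t w | coeff-⊕ s (p ⊖ q ⊖ r) w
        | coeff-⊖ (p ⊖ q) r w | coeff-⊖ p q w
        | coeff-⊖ ((s ⊕ p) ⊖ q) (t ⊕ r) w | coeff-⊖ (s ⊕ p) q w
        | coeff-⊕ s p w | coeff-⊕ t r w
  = identity (coeff s w) (coeff p w) (coeff q w) (coeff r w) (coeff t w)
  where
  identity : ∀ x′ x y z y′ → x′ + (x - y - z) - y′ ≡ (x′ + x) - y - (y′ + z)
  identity = solve-∀ ℚ-ring

◁-⊝ : ∀ c p → c ◁ ⊝ p ≡ ⊝ (c ◁ p)
◁-⊝ c []            = refl
◁-⊝ c ((k , u) ∷ p) = cong ((- k , c ∷ u) ∷_) (◁-⊝ c p)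

◁-⊖ : ∀ c p q → c ◁ (p ⊖ q) ≡ c ◁ p ⊖ c ◁ q
◁-⊖ c p q = trans (map-++ _ p (⊝ q)) (cong (c ◁ p ⊕_) (◁-⊝ c q))

◁-⊖⊖ : ∀ c p q r → c ◁ (p ⊖ q ⊖ r) ≡ c ◁ p ⊖ c ◁ q ⊖ c ◁ r
◁-⊖⊖ c p q r = trans (◁-⊖ c (p ⊖ q) r) (cong (_⊖ c ◁ r) (◁-⊖ c p q))

◁-▷-assoc : ∀ c p a → (c ◁ p) ▷ a ≡ c ◁ (p ▷ a)
◁-▷-assoc c []            a = refl
◁-▷-assoc c ((k , u) ∷ p) a = cong ((k , c ∷ u ∷ʳ a) ∷_) (◁-▷-assoc c p a)

◁⊕◁-▷ : ∀ c p d q a → (c ◁ p ⊕ d ◁ q) ▷ a ≡ c ◁ (p ▷ a) ⊕ d ◁ (q ▷ a)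
◁⊕◁-▷ c p d q a = trans (map-++ _ (c ◁ p) (d ◁ q)) (cong₂ _⊕_ (◁-▷-assoc c p a) (◁-▷-assoc d q a))

⧢-identityʳ : ∀ u → u ⧢ [] ≡ word u
⧢-identityʳ []      = refl
⧢-identityʳ (_ ∷ _) = refl

δ-∷ʳ : ∀ u a → δ (u ∷ʳ a) ≡ 0ℚ
δ-∷ʳ []      a = refl
δ-∷ʳ (_ ∷ _) a = refl

⊖-δ-∷ʳ : ∀ p u a q → p ⊖ δ (u ∷ʳ a) · q ≈ p
⊖-δ-∷ʳ p u a q rewrite δ-∷ʳ u a = ⊖-0· p q

open SetoidReasoning ≈-setoid

⧢⋆-expansion : Word → Letter → Word → Letter → Poly
⧢⋆-expansion u a v b =
  (u ∷ʳ a) ⧢ (v ∷ʳ b) ⊖ (u ⧢ (v ∷ʳ τ b)) ▷ a ⊖ ((u ∷ʳ τ a) ⧢ v) ▷ b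

-- δ [] · word w computes to word w: the sides differ only in the order of the τ-terms.
expansion-[]-[] : ∀ a b → [ a ] ⧢⋆ [ b ] ≈ ⧢⋆-expansion [] a [] b
expansion-[]-[] a b =
  ⊖-⊖-comm (a ◁ word [ b ] ⊕ b ◁ word [ a ]) (word (τ a ∷ b ∷ [])) (word (τ b ∷ a ∷ []))

expansion-∷-[] : ∀ c u a b →
  (u ∷ʳ a) ⧢⋆ [ b ] ≈ ⧢⋆-expansion u a [] b →
  (c ∷ u ∷ʳ a) ⧢⋆ [ b ] ≈ ⧢⋆-expansion (c ∷ u) a [] b
expansion-∷-[] c u a b ih = begin
  c ◁ P ⊕ S ⊖ δ (u ∷ʳ a) · Z ⊖ T
    ≈⟨ ⊖-congˡ (c ◁ P ⊕ S ⊖ δ (u ∷ʳ a) · Z) (c ◁ P ⊕ S) T (⊖-δ-∷ʳ (c ◁ P ⊕ S) u a Z) ⟩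
  c ◁ P ⊕ S ⊖ T
    ≈⟨ ⊖-congˡ (c ◁ P ⊕ S) (c ◁ F ⊕ S) T (⊕-congˡ (c ◁ P) (c ◁ F) S (◁-cong c P F ih)) ⟩
  c ◁ F ⊕ S ⊖ T
    ≡⟨ cong (λ x → x ⊕ S ⊖ T) (◁-⊖⊖ c A B C) ⟩
  (c ◁ A ⊖ c ◁ B ⊖ c ◁ C) ⊕ S ⊖ T
    ≈⟨ ⊖⊖-⊕-⊖ (c ◁ A) (c ◁ B) (c ◁ C) S T ⟩
  (c ◁ A ⊕ S) ⊖ (c ◁ B ⊕ T) ⊖ c ◁ C
    ≡⟨ cong₂ (λ x y → (c ◁ A ⊕ S) ⊖ x ⊖ y)
             (◁⊕◁-▷ c (u ⧢ [ τ b ]) (τ b) (word (c ∷ u)) a)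
             (sym (cong (λ x → c ◁ (x ▷ b)) (⧢-identityʳ (u ∷ʳ τ a)))) ⟨
  ⧢⋆-expansion (c ∷ u) a [] b
    ∎
  where
  P A B C F S T Z : Poly
  P = (u ∷ʳ a) ⧢⋆ [ b ]
  A = (u ∷ʳ a) ⧢ [ b ]
  B = (u ⧢ [ τ b ]) ▷ a
  C = ((u ∷ʳ τ a) ⧢ []) ▷ b
  F = A ⊖ B ⊖ C
  S = b ◁ word (c ∷ u ∷ʳ a)
  T = word (τ b ∷ c ∷ u ∷ʳ a)
  Z = word (τ c ∷ b ∷ [])

expansion-[]-∷ : ∀ d v a b →
  [ a ] ⧢⋆ (v ∷ʳ b) ≈ ⧢⋆-expansion [] a v b →
  [ a ] ⧢⋆ (d ∷ v ∷ʳ b) ≈ ⧢⋆-expansion [] a (d ∷ v) b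
expansion-[]-∷ d v a b ih = begin
  S ⊕ d ◁ P ⊖ T ⊖ δ (v ∷ʳ b) · Z
    ≈⟨ ⊖-δ-∷ʳ (S ⊕ d ◁ P ⊖ T) v b Z ⟩
  S ⊕ d ◁ P ⊖ T
    ≈⟨ ⊖-congˡ (S ⊕ d ◁ P) (S ⊕ d ◁ F) T (⊕-congʳ S (d ◁ P) (d ◁ F) (◁-cong d P F ih)) ⟩
  S ⊕ d ◁ F ⊖ T
    ≡⟨ cong (λ x → S ⊕ x ⊖ T) (◁-⊖⊖ d A B C) ⟩
  S ⊕ (d ◁ A ⊖ d ◁ B ⊖ d ◁ C) ⊖ T
    ≈⟨ ⊕-⊖⊖-⊖ S (d ◁ A) (d ◁ B) (d ◁ C) T ⟩
  (S ⊕ d ◁ A) ⊖ d ◁ B ⊖ (T ⊕ d ◁ C)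
    ≡⟨ cong (λ x → (S ⊕ d ◁ A) ⊖ d ◁ B ⊖ x) (◁⊕◁-▷ (τ a) (word (d ∷ v)) d ([ τ a ] ⧢ v) b) ⟨
  ⧢⋆-expansion [] a (d ∷ v) b
    ∎
  where
  P A B C F S T Z : Poly
  P = [ a ] ⧢⋆ (v ∷ʳ b)
  A = [ a ] ⧢ (v ∷ʳ b)
  B = ([] ⧢ (v ∷ʳ τ b)) ▷ a
  C = ([ τ a ] ⧢ v) ▷ b
  F = A ⊖ B ⊖ C
  S = a ◁ word (d ∷ v ∷ʳ b)
  T = word (τ a ∷ d ∷ v ∷ʳ b)
  Z = word (τ d ∷ a ∷ [])

expansion-∷-∷ : ∀ c u d v a b →
  (u ∷ʳ a) ⧢⋆ (d ∷ v ∷ʳ b) ≈ ⧢⋆-expansion u a (d ∷ v) b →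
  (c ∷ u ∷ʳ a) ⧢⋆ (v ∷ʳ b) ≈ ⧢⋆-expansion (c ∷ u) a v b →
  (c ∷ u ∷ʳ a) ⧢⋆ (d ∷ v ∷ʳ b) ≈ ⧢⋆-expansion (c ∷ u) a (d ∷ v) b
expansion-∷-∷ c u d v a b ih₁ ih₂ = begin
  c ◁ P₁ ⊕ d ◁ P₂ ⊖ δ (u ∷ʳ a) · Z₁ ⊖ δ (v ∷ʳ b) · Z₂
    ≈⟨ ⊖-δ-∷ʳ (c ◁ P₁ ⊕ d ◁ P₂ ⊖ δ (u ∷ʳ a) · Z₁) v b Z₂ ⟩
  c ◁ P₁ ⊕ d ◁ P₂ ⊖ δ (u ∷ʳ a) · Z₁
    ≈⟨ ⊖-δ-∷ʳ (c ◁ P₁ ⊕ d ◁ P₂) u a Z₁ ⟩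
  c ◁ P₁ ⊕ d ◁ P₂
    ≈⟨ ⊕-congˡ (c ◁ P₁) (c ◁ F₁) (d ◁ P₂) (◁-cong c P₁ F₁ ih₁) ⟩
  c ◁ F₁ ⊕ d ◁ P₂
    ≈⟨ ⊕-congʳ (c ◁ F₁) (d ◁ P₂) (d ◁ F₂) (◁-cong d P₂ F₂ ih₂) ⟩
  c ◁ F₁ ⊕ d ◁ F₂
    ≡⟨ cong₂ _⊕_ (◁-⊖⊖ c A₁ B₁ C₁) (◁-⊖⊖ d A₂ B₂ C₂) ⟩
  (c ◁ A₁ ⊖ c ◁ B₁ ⊖ c ◁ C₁) ⊕ (d ◁ A₂ ⊖ d ◁ B₂ ⊖ d ◁ C₂)
    ≈⟨ ⊖⊖-⊕-⊖⊖ (c ◁ A₁) (c ◁ B₁) (c ◁ C₁) (d ◁ A₂) (d ◁ B₂) (d ◁ C₂) ⟩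
  (c ◁ A₁ ⊕ d ◁ A₂) ⊖ (c ◁ B₁ ⊕ d ◁ B₂) ⊖ (c ◁ C₁ ⊕ d ◁ C₂)
    ≡⟨ cong₂ (λ x y → (c ◁ A₁ ⊕ d ◁ A₂) ⊖ x ⊖ y)
             (◁⊕◁-▷ c (u ⧢ (d ∷ v ∷ʳ τ b)) d ((c ∷ u) ⧢ (v ∷ʳ τ b)) a)
             (◁⊕◁-▷ c ((u ∷ʳ τ a) ⧢ (d ∷ v)) d ((c ∷ u ∷ʳ τ a) ⧢ v) b) ⟨
  ⧢⋆-expansion (c ∷ u) a (d ∷ v) b
    ∎
  where
  P₁ A₁ B₁ C₁ F₁ Z₁ P₂ A₂ B₂ C₂ F₂ Z₂ : Poly
  P₁ = (u ∷ʳ a) ⧢⋆ (d ∷ v ∷ʳ b)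
  A₁ = (u ∷ʳ a) ⧢ (d ∷ v ∷ʳ b)
  B₁ = (u ⧢ (d ∷ v ∷ʳ τ b)) ▷ a
  C₁ = ((u ∷ʳ τ a) ⧢ (d ∷ v)) ▷ b
  F₁ = A₁ ⊖ B₁ ⊖ C₁
  Z₁ = word (τ c ∷ d ∷ v ∷ʳ b)
  P₂ = (c ∷ u ∷ʳ a) ⧢⋆ (v ∷ʳ b)
  A₂ = (c ∷ u ∷ʳ a) ⧢ (v ∷ʳ b)
  B₂ = ((c ∷ u) ⧢ (v ∷ʳ τ b)) ▷ a
  C₂ = ((c ∷ u ∷ʳ τ a) ⧢ v) ▷ b
  F₂ = A₂ ⊖ B₂ ⊖ C₂
  Z₂ = word (τ d ∷ c ∷ u ∷ʳ a)

lemma6p6 : (u v : Word) (a b : Letter) →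
    (u ++ [ a ]) ⧢⋆ (v ++ [ b ]) ≈
      ((u ++ [ a ]) ⧢ (v ++ [ b ]))
        ⊖ ((u ⧢ (v ++ [ τ b ])) ▷ a)
        ⊖ (((u ++ [ τ a ]) ⧢ v) ▷ b)
lemma6p6 []      []      a b = expansion-[]-[] a b
lemma6p6 (c ∷ u) []      a b = expansion-∷-[] c u a b (lemma6p6 u [] a b)
lemma6p6 []      (d ∷ v) a b = expansion-[]-∷ d v a b (lemma6p6 [] v a b)
lemma6p6 (c ∷ u) (d ∷ v) a b =
  expansion-∷-∷ c u d v a b (lemma6p6 u (d ∷ v) a b) (lemma6p6 (c ∷ u) v a b)
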